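{- Let $n$ be a nonnegative integer. There is a delicate squarefree ternary word of length $n$ if and only if $n \in \{5\} \cup \{m \mid m \geq 7\}$.
   Context: Words are finite strings over the ternary alphabet $\{0,1,2\}$. A factor of a word is a contiguous subword. A square is a word of the form $XX$ with $X$ a nonempty word; a word is squarefree if none of its factors is a square. A delicate squarefree word is a nonempty squarefree word such that changing any single one of its letters to a different letter of the alphabet yields a word containing a square as a factor. -}

module Defs where

open import Data.Fin using (Fin)
open import Data.List using (List; []; _∷_; _++_; length; lookup; _[_]∷=_)
open import Data.Product using (Σ; ∃; _×_; _,_)
open import Relation.Binary.PropositionalEquality using (_≡_; _≢_)
open import Relation.Nullary using (¬_)

Letter : Set
Letter = Fin 3

Word : Set
Word = List Letter

Factor : Word → Word → Set
Factor f w = ∃ λ u → ∃ λ v → w ≡ u ++ f ++ v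

Square : Word → Set
Square s = ∃ λ X → (X ≢ []) × (s ≡ X ++ X)

ContainsSquare : Word → Set
ContainsSquare w = ∃ λ s → Factor s w × Square s

Squarefree : Word → Set
Squarefree w = ¬ ContainsSquare w

DelicateSquarefree : Word → Set
DelicateSquarefree w =
  (w ≢ []) × Squarefree w ×
  ((i : Fin (length w)) (a : Letter) → a ≢ lookup w i → ContainsSquare (w [ i ]∷= a))

-- Let t be the Thue–Morse word and τ(n) = 1 + t(n+1) − t(n). Since t is
-- overlap-free, τ is squarefree, and so is each of its factors. A factor is
-- delicate once each of its letters is forced (every change creates a
-- square), and this can be witnessed locally: an interior letter inside a
-- factor of length 4, an extreme letter inside a factor of length 8. Every
-- factor of t of length 18 already occurs before position 96 (the factors
-- listed are closed under t(2n) = t(n), t(2n + 1) = ¬ t(n)), so these local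
-- conditions are finitely checkable, and they give a delicate factor of τ of
-- every length ≥ 8. Shorter lengths are settled by exhaustive search and the
-- explicit words 01210 and 0102101.
module Submission where

open import Defs
open import Data.Bool using (Bool; true; false; not; _xor_)
open import Data.Bool.Properties using (not-involutive; not-¬; not-distribˡ-xor) renaming (_≟_ to _≟ᵇ_)
open import Data.Empty using (⊥-elim)
open import Data.Fin using (Fin; zero; suc; toℕ; #_)
open import Data.Fin.Properties using (all?; toℕ<n) renaming (_≟_ to _≟ᶠ_)
open import Data.List using (List; []; _∷_; _++_; length; lookup; _[_]∷=_; upTo)
open import Data.List.Properties using (∷-injective; ++-assoc; ≡-dec)
open import Data.List.Relation.Unary.All using (All; lookupAny) renaming (all? to allᴸ?)
open import Data.List.Relation.Unary.Any using (Any; here; any?) renaming (map to mapAny)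
open import Data.Nat using (ℕ; zero; suc; _+_; _≤_; _<_; _≥_; _≟_; z≤n; s≤s; s≤s⁻¹; ⌊_/2⌋)
open import Data.Nat.Induction using (<-rec)
open import Data.Nat.Properties
  using (≤-refl; ≤-trans; <-≤-trans; n<1+n; m≤m+n; m≤n+m; m<n+m; +-suc; +-comm; +-assoc; ≤-reflexive; +-identityʳ;
         +-mono-≤; +-mono-<; +-monoˡ-<; +-monoˡ-≤; suc-injective; ⌊n/2⌋<n; <⇒≢; <⇒≤; m<n⇒m<1+n; m≤n⇒∃[o]m+o≡n)
open import Data.Nat.Tactic.RingSolver using (solve-∀)
open import Data.Product using (∃; ∃₂; _×_; _,_; proj₁; proj₂)
open import Data.Sum using (_⊎_; inj₁; inj₂)
open import Data.Unit using (tt)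
open import Function using (_∘_)
open import Function.Bundles using (_⇔_; mk⇔)
open import Relation.Binary.PropositionalEquality
open import Relation.Nullary using (Dec; yes; no; ¬_; contradiction)
open import Relation.Nullary.Decidable using (True; map′; _×-dec_; _⊎-dec_; _→-dec_; ¬?; toWitness)

open ≡-Reasoning

-- Deciding squares and delicacy

_≟ʷ_ : (u v : Word) → Dec (u ≡ v)
_≟ʷ_ = ≡-dec _≟ᶠ_

splits? : {A : Set} {P : List A → List A → Set} → (∀ u v → Dec (P u v)) →
          (w : List A) → Dec (∃₂ λ u v → w ≡ u ++ v × P u v)
splits? P? [] = map′ (λ p → [] , [] , refl , p) (λ { ([] , [] , refl , p) → p }) (P? [] [])
splits? {P = P} P? (x ∷ w) = map′ to from (P? [] (x ∷ w) ⊎-dec splits? (λ u → P? (x ∷ u)) w)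
  where
  to : P [] (x ∷ w) ⊎ (∃₂ λ u v → w ≡ u ++ v × P (x ∷ u) v) → ∃₂ λ u v → x ∷ w ≡ u ++ v × P u v
  to (inj₁ p) = [] , x ∷ w , refl , p
  to (inj₂ (u , v , eq , p)) = x ∷ u , v , cong (x ∷_) eq , p
  from : (∃₂ λ u v → x ∷ w ≡ u ++ v × P u v) → P [] (x ∷ w) ⊎ (∃₂ λ u v → w ≡ u ++ v × P (x ∷ u) v)
  from ([] , v , eq , p) = inj₁ (subst (P []) (sym eq) p)
  from (y ∷ u , v , eq , p) with refl ← proj₁ (∷-injective eq) = inj₂ (u , v , proj₂ (∷-injective eq) , p)

prefix? : (X z : Word) → Dec (∃ λ v → z ≡ X ++ v)
prefix? [] z = yes (z , refl)
prefix? (x ∷ X) [] = no λ ()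
prefix? (x ∷ X) (y ∷ z) with x ≟ᶠ y | prefix? X z
... | yes refl | yes (v , refl) = yes (v , refl)
... | yes refl | no ¬prefix = no λ (v , eq) → ¬prefix (v , proj₂ (∷-injective eq))
... | no x≢y | _ = no λ (v , eq) → x≢y (sym (proj₁ (∷-injective eq)))

SquareSplit : Word → Set
SquareSplit w = ∃₂ λ u r → w ≡ u ++ r × ∃₂ λ X z → r ≡ X ++ z × X ≢ [] × ∃ λ v → z ≡ X ++ v

squareSplit⇒containsSquare : ∀ {w} → SquareSplit w → ContainsSquare w
squareSplit⇒containsSquare (u , _ , refl , X , _ , refl , X≢[] , v , refl) =
  X ++ X , (u , v , cong (u ++_) (sym (++-assoc X X v))) , X , X≢[] , refl

containsSquare⇒squareSplit : ∀ {w} → ContainsSquare w → SquareSplit w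
containsSquare⇒squareSplit (_ , (u , v , refl) , X , X≢[] , refl) =
  u , X ++ X ++ v , cong (u ++_) (++-assoc X X v) , X , X ++ v , refl , X≢[] , v , refl

containsSquare? : ∀ w → Dec (ContainsSquare w)
containsSquare? w = map′ squareSplit⇒containsSquare containsSquare⇒squareSplit
  (splits? (λ _ → splits? (λ X z → ¬? (X ≟ʷ []) ×-dec prefix? X z)) w)

delicateSquarefree? : ∀ w → Dec (DelicateSquarefree w)
delicateSquarefree? w =
  ¬? (w ≟ʷ []) ×-dec ¬? (containsSquare? w) ×-dec
  all? λ i → all? λ a → ¬? (a ≟ᶠ lookup w i) →-dec containsSquare? (w [ i ]∷= a)

∀-ofLength? : {P : Word → Set} → (∀ w → Dec (P w)) → ∀ n → Dec (∀ w → length w ≡ n → P w)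
∀-ofLength? P? zero = map′ (λ p → λ { [] _ → p ; (_ ∷ _) () }) (λ f → f [] refl) (P? [])
∀-ofLength? P? (suc n) =
  map′ (λ f → λ { (a ∷ w) eq → f a w (suc-injective eq) }) (λ f a w eq → f (a ∷ w) (cong suc eq))
       (all? λ a → ∀-ofLength? (λ w → P? (a ∷ w)) n)

NoDelicateOfLength : ℕ → Set
NoDelicateOfLength n = ∀ w → length w ≡ n → ¬ DelicateSquarefree w

noDelicateOfLength? : ∀ n → Dec (NoDelicateOfLength n)
noDelicateOfLength? = ∀-ofLength? (λ w → ¬? (delicateSquarefree? w))

-- Factors of infinite words

module _ {A : Set} where

  window : (ℕ → A) → ℕ → ℕ → List A
  window f i zero = []
  window f i (suc n) = f i ∷ window f (suc i) n

  length-window : ∀ f i n → length (window f i n) ≡ n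
  length-window f i zero = refl
  length-window f i (suc n) = cong suc (length-window f (suc i) n)

  lookup-window : ∀ f i n (k : Fin (length (window f i n))) → lookup (window f i n) k ≡ f (toℕ k + i)
  lookup-window f i (suc n) zero = refl
  lookup-window f i (suc n) (suc k) = trans (lookup-window f (suc i) n k) (cong f (+-suc (toℕ k) i))

  window-++ : ∀ f i m n → window f i (m + n) ≡ window f i m ++ window f (m + i) n
  window-++ f i zero n = refl
  window-++ f i (suc m) n =
    cong (f i ∷_) (trans (window-++ f (suc i) m n) (cong (λ j → window f (suc i) m ++ window f j n) (+-suc m i)))

  window-≡⁻ : ∀ {f g : ℕ → A} {i j} n → window f i n ≡ window g j n → ∀ k → k < n → f (k + i) ≡ g (k + j)
  window-≡⁻ (suc n) eq zero _ = proj₁ (∷-injective eq)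
  window-≡⁻ {f} {g} {i} {j} (suc n) eq (suc k) (s≤s k<n) = begin
    f (suc (k + i)) ≡⟨ cong f (+-suc k i) ⟨
    f (k + suc i)   ≡⟨ window-≡⁻ n (proj₂ (∷-injective eq)) k k<n ⟩
    g (k + suc j)   ≡⟨ cong g (+-suc k j) ⟩
    g (suc (k + j)) ∎

  window-≡⁺ : ∀ {f g : ℕ → A} {i j} n → (∀ k → k < n → f (k + i) ≡ g (k + j)) → window f i n ≡ window g j n
  window-≡⁺ zero _ = refl
  window-≡⁺ {f} {g} {i} {j} (suc n) eq = cong₂ _∷_ (eq 0 (s≤s z≤n)) (window-≡⁺ n shifted)
    where
    shifted : ∀ k → k < n → f (k + suc i) ≡ g (k + suc j)
    shifted k k<n = begin
      f (k + suc i)   ≡⟨ cong f (+-suc k i) ⟩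
      f (suc (k + i)) ≡⟨ eq (suc k) (s≤s k<n) ⟩
      g (suc (k + j)) ≡⟨ cong g (+-suc k j) ⟨
      g (k + suc j)   ∎

  window-≡-sub : ∀ {f g : ℕ → A} {i j} n k m → k + m ≤ n →
                 window f i n ≡ window g j n → window f (k + i) m ≡ window g (k + j) m
  window-≡-sub {f} {g} {i} {j} n k m k+m≤n eq = window-≡⁺ m λ x x<m → begin
    f (x + (k + i)) ≡⟨ cong f (+-assoc x k i) ⟨
    f (x + k + i)   ≡⟨ window-≡⁻ n eq (x + k) (inside x<m) ⟩
    g (x + k + j)   ≡⟨ cong g (+-assoc x k j) ⟩
    g (x + (k + j)) ∎
    where
    inside : ∀ {x} → x < m → x + k < n
    inside x<m = <-≤-trans (+-monoˡ-< k x<m) (≤-trans (≤-reflexive (+-comm m k)) k+m≤n)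

  window-split : ∀ f i n u v → window f i n ≡ u ++ v →
                 u ≡ window f i (length u) × ∃ λ m → v ≡ window f (length u + i) m
  window-split f i n [] v eq = refl , n , sym eq
  window-split f i (suc n) (x ∷ u) v eq with refl ← proj₁ (∷-injective eq)
    with window-split f (suc i) n u v (proj₂ (∷-injective eq))
  ... | u≡ , m , v≡ = cong (f i ∷_) u≡ , m , trans v≡ (cong (λ j → window f j m) (+-suc (length u) i))

  update : (ℕ → A) → ℕ → A → ℕ → A
  update f m a x with x ≟ m
  ... | yes _ = a
  ... | no _ = f x

  update-same : ∀ f m a → update f m a m ≡ a
  update-same f m a with m ≟ m
  ... | yes _ = refl
  ... | no m≢m = contradiction refl m≢m

  update-other : ∀ f m a x → x ≢ m → update f m a x ≡ f x
  update-other f m a x x≢m with x ≟ m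
  ... | yes x≡m = contradiction x≡m x≢m
  ... | no _ = refl

  window-update-before : ∀ f m a i n → m < i → window (update f m a) i n ≡ window f i n
  window-update-before f m a i n m<i =
    window-≡⁺ n λ k _ → update-other f m a (k + i) λ k+i≡m → <⇒≢ (<-≤-trans m<i (m≤n+m i k)) (sym k+i≡m)

  setAt : List A → ℕ → A → List A
  setAt [] o a = []
  setAt (x ∷ w) zero a = a ∷ w
  setAt (x ∷ w) (suc o) a = x ∷ setAt w o a

  ∷=-setAt : ∀ w (k : Fin (length w)) a → w [ k ]∷= a ≡ setAt w (toℕ k) a
  ∷=-setAt (x ∷ w) zero a = refl
  ∷=-setAt (x ∷ w) (suc k) a = cong (x ∷_) (∷=-setAt w k a)

  window-update : ∀ f s ℓ o a → o < ℓ → window (update f (o + s) a) s ℓ ≡ setAt (window f s ℓ) o a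
  window-update f s (suc ℓ) zero a _ =
    cong₂ _∷_ (update-same f s a) (window-update-before f s a (suc s) ℓ (n<1+n s))
  window-update f s (suc ℓ) (suc o) a (s≤s o<ℓ) = cong₂ _∷_
    (update-other f (suc o + s) a s (<⇒≢ (m<n+m s (s≤s z≤n))))
    (trans (cong (λ m → window (update f m a) (suc s) ℓ) (sym (+-suc o s))) (window-update f (suc s) ℓ o a o<ℓ))

containsSquare-infix : ∀ u w v → ContainsSquare w → ContainsSquare (u ++ w ++ v)
containsSquare-infix u w v (s , (x , y , refl) , sq) = s , (u ++ x , y ++ v , arrange) , sq
  where
  arrange : u ++ (x ++ s ++ y) ++ v ≡ (u ++ x) ++ s ++ y ++ v
  arrange = begin
    u ++ (x ++ s ++ y) ++ v ≡⟨ cong (u ++_) (++-assoc x (s ++ y) v) ⟩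
    u ++ x ++ (s ++ y) ++ v ≡⟨ cong (λ z → u ++ x ++ z) (++-assoc s y v) ⟩
    u ++ x ++ s ++ y ++ v   ≡⟨ ++-assoc u x (s ++ y ++ v) ⟨
    (u ++ x) ++ s ++ y ++ v ∎

-- A square of period p at j is Repeats f j p p, an overlap is Repeats f j p (suc p).
Repeats : {A : Set} → (ℕ → A) → ℕ → ℕ → ℕ → Set
Repeats f j p n = ∀ k → k < n → f (k + j) ≡ f (k + (p + j))

window-squarefree : ∀ (f : ℕ → Letter) → (∀ j p → 0 < p → ¬ Repeats f j p p) →
                    ∀ i n → Squarefree (window f i n)
window-squarefree f squarefree i n (_ , (u , v , eq) , X , X≢[] , refl)
  with _ , m , XXv≡ ← window-split f i n u _ eq
  with X≡ , _ , Xv≡ ← window-split f _ m X (X ++ v) (trans (sym XXv≡) (++-assoc X X v))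
  with X≡′ , _ ← window-split f _ _ X v (sym Xv≡) =
  squarefree _ (length X) (nonempty X X≢[]) (window-≡⁻ (length X) (trans (sym X≡) X≡′))
  where
  nonempty : ∀ (Y : Word) → Y ≢ [] → 0 < length Y
  nonempty [] Y≢[] = contradiction refl Y≢[]
  nonempty (_ ∷ _) _ = s≤s z≤n

-- The Thue–Morse word

isOdd : ℕ → Bool
isOdd zero = false
isOdd (suc n) = not (isOdd n)

-- t(n) is the parity of the binary digit sum of n; any fuel exceeding the
-- number of binary digits gives the same value.
thueMorseFuel : ℕ → ℕ → Bool
thueMorseFuel zero n = false
thueMorseFuel (suc f) n = isOdd n xor thueMorseFuel f ⌊ n /2⌋

thueMorseFuel-zero : ∀ f → thueMorseFuel f 0 ≡ false
thueMorseFuel-zero zero = refl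
thueMorseFuel-zero (suc f) = thueMorseFuel-zero f

thueMorseFuel-irrelevant : ∀ f g n → n ≤ f → n ≤ g → thueMorseFuel f n ≡ thueMorseFuel g n
thueMorseFuel-irrelevant f g zero _ _ = trans (thueMorseFuel-zero f) (sym (thueMorseFuel-zero g))
thueMorseFuel-irrelevant (suc f) (suc g) (suc n) n≤f n≤g =
  cong (isOdd (suc n) xor_) (thueMorseFuel-irrelevant f g ⌊ suc n /2⌋ (half≤ n≤f) (half≤ n≤g))
  where
  half≤ : ∀ {h} → suc n ≤ suc h → ⌊ suc n /2⌋ ≤ h
  half≤ n≤h = s≤s⁻¹ (<-≤-trans (⌊n/2⌋<n n) n≤h)

-- Opaque: unfolding t on open terms makes conversion checking blow up.
opaque
  thueMorse : ℕ → Bool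
  thueMorse n = thueMorseFuel n n

  thueMorse-unfold : ∀ n → thueMorse n ≡ isOdd n xor thueMorse ⌊ n /2⌋
  thueMorse-unfold zero = refl
  thueMorse-unfold (suc n) =
    cong (isOdd (suc n) xor_) (thueMorseFuel-irrelevant n ⌊ suc n /2⌋ ⌊ suc n /2⌋ (s≤s⁻¹ (⌊n/2⌋<n n)) ≤-refl)

isOdd-double : ∀ m → isOdd (m + m) ≡ false
isOdd-double zero = refl
isOdd-double (suc m) = trans (cong (λ n → not (isOdd n)) (+-suc m m)) (trans (not-involutive _) (isOdd-double m))

half-double : ∀ m → ⌊ m + m /2⌋ ≡ m
half-double zero = refl
half-double (suc m) = trans (cong (λ n → ⌊ suc n /2⌋) (+-suc m m)) (cong suc (half-double m))

half-double+1 : ∀ m → ⌊ suc (m + m) /2⌋ ≡ m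
half-double+1 zero = refl
half-double+1 (suc m) = trans (cong (λ n → ⌊ suc (suc n) /2⌋) (+-suc m m)) (cong suc (half-double+1 m))

thueMorse-double : ∀ m → thueMorse (m + m) ≡ thueMorse m
thueMorse-double m = trans (thueMorse-unfold (m + m)) (cong₂ _xor_ (isOdd-double m) (cong thueMorse (half-double m)))

thueMorse-double+1 : ∀ m → thueMorse (suc (m + m)) ≡ not (thueMorse m)
thueMorse-double+1 m =
  trans (thueMorse-unfold (suc (m + m))) (cong₂ _xor_ (cong not (isOdd-double m)) (cong thueMorse (half-double+1 m)))

thueMorse-flip : ∀ n m → n ≡ m + m → thueMorse (suc n) ≡ not (thueMorse n)
thueMorse-flip _ m refl = trans (thueMorse-double+1 m) (cong not (sym (thueMorse-double m)))

parity : ∀ n → ∃ λ m → n ≡ m + m ⊎ n ≡ suc (m + m)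
parity zero = 0 , inj₁ refl
parity (suc n) with parity n
... | m , inj₁ n≡ = m , inj₂ (cong suc n≡)
... | m , inj₂ n≡ = suc m , inj₁ (cong suc (trans n≡ (sym (+-suc m m))))

-- An odd period p forces t to alternate along the overlap, so t(i) ≠ t(p + i).
¬repeats-oddPeriod : ∀ i q → ¬ Repeats thueMorse i (suc (q + q)) (suc (suc (q + q)))
¬repeats-oddPeriod i q rep =
  not-¬ refl (trans (rep 0 (s≤s z≤n)) (trans (alternate p ≤-refl) (cong (_xor thueMorse i) isOdd-p)))
  where
  p = suc (q + q)

  isOdd-p : isOdd p ≡ true
  isOdd-p = cong not (isOdd-double q)

  shift : ∀ x m → x + i ≡ suc (m + m) → x + (p + i) ≡ suc (m + q) + suc (m + q)
  shift x m x+i≡ = begin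
    x + (p + i)               ≡⟨ regroup x q i ⟩
    x + i + p                 ≡⟨ cong (_+ p) x+i≡ ⟩
    suc (m + m) + p           ≡⟨ regroup′ m q ⟩
    suc (m + q) + suc (m + q) ∎
    where
    regroup : ∀ x q i → x + (suc (q + q) + i) ≡ x + i + suc (q + q)
    regroup = solve-∀
    regroup′ : ∀ m q → suc (m + m) + suc (q + q) ≡ suc (m + q) + suc (m + q)
    regroup′ = solve-∀

  adjacent : ∀ x → x < p → thueMorse (suc (x + i)) ≡ not (thueMorse (x + i))
  adjacent x x<p with parity (x + i)
  ... | m , inj₁ x+i≡ = thueMorse-flip (x + i) m x+i≡
  ... | m , inj₂ x+i≡ = begin
    thueMorse (suc x + i)             ≡⟨ rep (suc x) (s≤s x<p) ⟩
    thueMorse (suc (x + (p + i)))     ≡⟨ thueMorse-flip _ (suc (m + q)) (shift x m x+i≡) ⟩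
    not (thueMorse (x + (p + i)))     ≡⟨ cong not (rep x (m<n⇒m<1+n x<p)) ⟨
    not (thueMorse (x + i))           ∎

  alternate : ∀ x → x ≤ p → thueMorse (x + i) ≡ isOdd x xor thueMorse i
  alternate zero _ = refl
  alternate (suc x) x<p = begin
    thueMorse (suc (x + i))            ≡⟨ adjacent x x<p ⟩
    not (thueMorse (x + i))            ≡⟨ cong not (alternate x (<⇒≤ x<p)) ⟩
    not (isOdd x xor thueMorse i)      ≡⟨ not-distribˡ-xor (isOdd x) (thueMorse i) ⟩
    not (isOdd x) xor thueMorse i      ∎

repeats-halve : ∀ i q → Repeats thueMorse i (q + q) (suc (q + q)) → ∃ λ m → Repeats thueMorse m q (suc q)
repeats-halve i q rep with parity i
... | m , inj₁ refl = m , halved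
  where
  halved : Repeats thueMorse m q (suc q)
  halved l (s≤s l≤q) = begin
    thueMorse (l + m)                         ≡⟨ thueMorse-double (l + m) ⟨
    thueMorse ((l + m) + (l + m))             ≡⟨ cong thueMorse (regroup l m) ⟩
    thueMorse ((l + l) + (m + m))             ≡⟨ rep (l + l) (s≤s (+-mono-≤ l≤q l≤q)) ⟩
    thueMorse ((l + l) + ((q + q) + (m + m))) ≡⟨ cong thueMorse (regroup′ l q m) ⟩
    thueMorse ((l + (q + m)) + (l + (q + m))) ≡⟨ thueMorse-double (l + (q + m)) ⟩
    thueMorse (l + (q + m))                   ∎
    where
    regroup : ∀ l m → (l + m) + (l + m) ≡ (l + l) + (m + m)
    regroup = solve-∀
    regroup′ : ∀ l q m → (l + l) + ((q + q) + (m + m)) ≡ (l + (q + m)) + (l + (q + m))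
    regroup′ = solve-∀
... | m , inj₂ refl = m , halved
  where
  halved : Repeats thueMorse m q (suc q)
  halved zero _ = begin
    thueMorse m                                   ≡⟨ not-involutive _ ⟨
    not (not (thueMorse m))                       ≡⟨ cong not (thueMorse-double+1 m) ⟨
    not (thueMorse (suc (m + m)))                 ≡⟨ cong not (rep 0 (s≤s z≤n)) ⟩
    not (thueMorse ((q + q) + suc (m + m)))       ≡⟨ cong (λ n → not (thueMorse n)) (regroup q m) ⟩
    not (thueMorse (suc ((q + m) + (q + m))))     ≡⟨ cong not (thueMorse-double+1 (q + m)) ⟩
    not (not (thueMorse (q + m)))                 ≡⟨ not-involutive _ ⟩
    thueMorse (q + m)                             ∎
    where
    regroup : ∀ q m → (q + q) + suc (m + m) ≡ suc ((q + m) + (q + m))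
    regroup = solve-∀
  halved (suc l) (s≤s l<q) = begin
    thueMorse (suc l + m)                                  ≡⟨ thueMorse-double (suc l + m) ⟨
    thueMorse ((suc l + m) + (suc l + m))                  ≡⟨ cong thueMorse (regroup l m) ⟩
    thueMorse (suc (l + l) + suc (m + m))                  ≡⟨ rep (suc (l + l)) (s≤s (+-mono-< l<q l<q)) ⟩
    thueMorse (suc (l + l) + ((q + q) + suc (m + m)))      ≡⟨ cong thueMorse (regroup′ l q m) ⟩
    thueMorse ((suc l + (q + m)) + (suc l + (q + m)))      ≡⟨ thueMorse-double (suc l + (q + m)) ⟩
    thueMorse (suc l + (q + m))                            ∎
    where
    regroup : ∀ l m → (suc l + m) + (suc l + m) ≡ suc (l + l) + suc (m + m)
    regroup = solve-∀
    regroup′ : ∀ l q m → suc (l + l) + ((q + q) + suc (m + m)) ≡ (suc l + (q + m)) + (suc l + (q + m))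
    regroup′ = solve-∀

thueMorse-overlapFree : ∀ p i → 0 < p → ¬ Repeats thueMorse i p (suc p)
thueMorse-overlapFree = <-rec (λ p → ∀ i → 0 < p → ¬ Repeats thueMorse i p (suc p)) overlapFree
  where
  overlapFree : ∀ p → (∀ {q} → q < p → ∀ i → 0 < q → ¬ Repeats thueMorse i q (suc q)) →
                ∀ i → 0 < p → ¬ Repeats thueMorse i p (suc p)
  overlapFree p below i 0<p rep with parity p
  ... | q , inj₂ refl = ¬repeats-oddPeriod i q rep
  ... | zero , inj₁ refl = contradiction 0<p λ ()
  ... | suc q , inj₁ refl with m , rep′ ← repeats-halve i (suc q) rep =
    below (s≤s (m≤n+m (suc q) q)) m (s≤s z≤n) rep′

-- The squarefree ternary word τ

slope : Bool → Bool → Letter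
slope false false = suc zero
slope false true = suc (suc zero)
slope true false = zero
slope true true = suc zero

τ : ℕ → Letter
τ n = slope (thueMorse n) (thueMorse (suc n))

slope-injectiveʳ : ∀ x {y y′} → slope x y ≡ slope x y′ → y ≡ y′
slope-injectiveʳ false {false} {false} _ = refl
slope-injectiveʳ false {true} {true} _ = refl
slope-injectiveʳ true {false} {false} _ = refl
slope-injectiveʳ true {true} {true} _ = refl

slope-≢ : ∀ {x x′ y y′} → x ≢ x′ → slope x y ≡ slope x′ y′ → y ≡ x × y′ ≡ x′
slope-≢ {false} {false} x≢x′ _ = contradiction refl x≢x′
slope-≢ {true} {true} x≢x′ _ = contradiction refl x≢x′
slope-≢ {false} {true} {false} {true} _ _ = refl , refl
slope-≢ {true} {false} {true} {false} _ _ = refl , refl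
slope-≢ {false} {true} {false} {false} _ ()
slope-≢ {false} {true} {true} {false} _ ()
slope-≢ {false} {true} {true} {true} _ ()
slope-≢ {true} {false} {false} {false} _ ()
slope-≢ {true} {false} {false} {true} _ ()
slope-≢ {true} {false} {true} {true} _ ()

-- A square in τ lifts to an overlap in t when both halves start with the same
-- bit; otherwise the slopes force t to be constant along the square.
τ-squarefree : ∀ j p → 0 < p → ¬ Repeats τ j p p
τ-squarefree j p 0<p sq with thueMorse j ≟ᵇ thueMorse (p + j)
... | yes equal = thueMorse-overlapFree p j 0<p lifted
  where
  lifted : Repeats thueMorse j p (suc p)
  lifted zero _ = equal
  lifted (suc k) (s≤s k<p) =
    slope-injectiveʳ (thueMorse (k + j))
      (trans (sq k k<p) (cong (λ x → slope x (thueMorse (suc k + (p + j)))) (sym (lifted k (m<n⇒m<1+n k<p)))))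
... | no differ = differ (sym (proj₁ (constant p ≤-refl)))
  where
  constant : ∀ k → k ≤ p → thueMorse (k + j) ≡ thueMorse j × thueMorse (k + (p + j)) ≡ thueMorse (p + j)
  constant zero _ = refl , refl
  constant (suc k) k<p with left , right ← constant k (<⇒≤ k<p)
    with y≡x , y′≡x′ ← slope-≢ (λ same → differ (trans (sym left) (trans same right))) (sq k k<p) =
    trans y≡x left , trans y′≡x′ right

-- Factors of the Thue–Morse word

μ : List Bool → List Bool
μ [] = []
μ (b ∷ bs) = b ∷ not b ∷ μ bs

window-thueMorse-double : ∀ q n → window thueMorse (q + q) (n + n) ≡ μ (window thueMorse q n)
window-thueMorse-double q zero = refl
window-thueMorse-double q (suc n) = begin
  window thueMorse (q + q) (suc n + suc n)
    ≡⟨ cong (λ m → window thueMorse (q + q) (suc m)) (+-suc n n) ⟩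
  thueMorse (q + q) ∷ thueMorse (suc (q + q)) ∷ window thueMorse (suc (suc (q + q))) (n + n)
    ≡⟨ cong₂ _∷_ (thueMorse-double q) (cong₂ _∷_ (thueMorse-double+1 q)
         (cong (λ i → window thueMorse (suc i) (n + n)) (sym (+-suc q q)))) ⟩
  thueMorse q ∷ not (thueMorse q) ∷ window thueMorse (suc q + suc q) (n + n)
    ≡⟨ cong (λ w → thueMorse q ∷ not (thueMorse q) ∷ w) (window-thueMorse-double (suc q) n) ⟩
  μ (window thueMorse q (suc n)) ∎

window-thueMorse-double-≡ : ∀ {q p} (b : Fin 2) → window thueMorse q 18 ≡ window thueMorse p 18 →
  window thueMorse (toℕ b + (q + q)) 18 ≡ window thueMorse (toℕ b + (p + p)) 18
window-thueMorse-double-≡ {q} {p} b eq =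
  window-≡-sub {f = thueMorse} {thueMorse} {q + q} {p + p} 20 (toℕ b) 18 (+-monoˡ-≤ 18 (<⇒≤ (toℕ<n b))) doubled
  where
  doubled : window thueMorse (q + q) 20 ≡ window thueMorse (p + p) 20
  doubled = begin
    window thueMorse (q + q) 20   ≡⟨ window-thueMorse-double q 10 ⟩
    μ (window thueMorse q 10)
      ≡⟨ cong μ (window-≡-sub {f = thueMorse} {thueMorse} {q} {p} 18 0 10 (m≤m+n 10 8) eq) ⟩
    μ (window thueMorse p 10)     ≡⟨ window-thueMorse-double p 10 ⟨
    window thueMorse (p + p) 20   ∎

-- The first occurrences of the 52 distinct factors of length 18 of t.
factorStarts : List ℕ
factorStarts = upTo 48 ++ 63 ∷ 79 ∷ 87 ∷ 95 ∷ []

Represented : List Bool → Set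
Represented w = Any (λ p → w ≡ window thueMorse p 18) factorStarts

represented? : ∀ w → Dec (Represented w)
represented? w = any? (λ p → ≡-dec _≟ᵇ_ w (window thueMorse p 18)) factorStarts

opaque
  unfolding thueMorse
  factorStarts-closed : All (λ p → (b : Fin 2) → Represented (window thueMorse (toℕ b + (p + p)) 18)) factorStarts
  factorStarts-closed =
    toWitness {a? = allᴸ? (λ p → all? λ b → represented? (window thueMorse (toℕ b + (p + p)) 18)) factorStarts} tt

thueMorse-factor-represented : ∀ k → Represented (window thueMorse k 18)
thueMorse-factor-represented = <-rec (λ k → Represented (window thueMorse k 18)) represented
  where
  doubled : ∀ {q} (b : Fin 2) → Represented (window thueMorse q 18) → Represented (window thueMorse (toℕ b + (q + q)) 18)
  doubled b rep with closed , eq ← lookupAny factorStarts-closed rep =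
    mapAny (trans (window-thueMorse-double-≡ b eq)) (closed b)

  represented : ∀ k → (∀ {q} → q < k → Represented (window thueMorse q 18)) → Represented (window thueMorse k 18)
  represented k below with parity k
  ... | zero , inj₁ refl = here refl
  ... | suc q , inj₁ refl = doubled zero (below (s≤s (m≤n+m (suc q) q)))
  ... | q , inj₂ refl = doubled (suc zero) (below (s≤s (m≤n+m q q)))

window-τ-≡ : ∀ {k p} n → window thueMorse k (suc n) ≡ window thueMorse p (suc n) → window τ k n ≡ window τ p n
window-τ-≡ n eq = window-≡⁺ n λ x x<n →
  cong₂ slope (window-≡⁻ (suc n) eq x (m<n⇒m<1+n x<n)) (window-≡⁻ (suc n) eq (suc x) (s≤s x<n))

-- Locally forced letters

-- For o < length w, setAt w o a ≢ w says that a differs from the letter at o.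
Forced : Word → ℕ → Set
Forced w o = ∀ a → setAt w o a ≢ w → ContainsSquare (setAt w o a)

forced? : ∀ w o → Dec (Forced w o)
forced? w o = all? λ a → ¬? (setAt w o a ≟ʷ w) →-dec containsSquare? (setAt w o a)

forcedFactor⇒square : ∀ {f : ℕ → Letter} {t s c ℓ r o m n a} →
                      o < ℓ → Forced (window f s ℓ) o → a ≢ f m → m ≡ o + s → s ≡ c + t → n ≡ c + (ℓ + r) →
                      ContainsSquare (window (update f m a) t n)
forcedFactor⇒square {f} {t} {s} {c} {ℓ} {r} {o} {a = a} o<ℓ forced a≢ refl refl refl =
  subst ContainsSquare (sym split)
    (containsSquare-infix (window g t c) (window g s ℓ) (window g (ℓ + s) r)
      (subst ContainsSquare (sym middle) (forced a changed)))
  where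
  g = update f (o + s) a
  split : window g t (c + (ℓ + r)) ≡ window g t c ++ window g s ℓ ++ window g (ℓ + s) r
  split = trans (window-++ g t c (ℓ + r)) (cong (window g t c ++_) (window-++ g s ℓ r))
  middle : window g s ℓ ≡ setAt (window f s ℓ) o a
  middle = window-update f s ℓ o a o<ℓ
  changed : setAt (window f s ℓ) o a ≢ window f s ℓ
  changed eq = a≢ (trans (sym (update-same f (o + s) a)) (window-≡⁻ ℓ (trans middle eq) o o<ℓ))

InteriorForced StartForced EndForced : ℕ → Set
InteriorForced j = Forced (window τ j 4) 1 × Forced (window τ j 4) 2
StartForced j = Forced (window τ j 8) 0
EndForced j = Forced (window τ j 8) 7

LocallyForced : ℕ → Set
LocallyForced j = InteriorForced j × (EndForced j ⊎ EndForced (2 + j) ⊎ EndForced (9 + j))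

locallyForced? : ∀ j → Dec (LocallyForced j)
locallyForced? j =
  (forced? (window τ j 4) 1 ×-dec forced? (window τ j 4) 2) ×-dec
  (forced? (window τ j 8) 7 ⊎-dec forced? (window τ (2 + j) 8) 7 ⊎-dec forced? (window τ (9 + j) 8) 7)

locallyForced-transfer : ∀ {k p} → window τ k 17 ≡ window τ p 17 → LocallyForced p → LocallyForced k
locallyForced-transfer {k} {p} eq ((inner₁ , inner₂) , end) =
  (move 0 4 1 (m≤m+n 4 13) inner₁ , move 0 4 2 (m≤m+n 4 13) inner₂) , moveEnd end
  where
  move : ∀ i ℓ o → i + ℓ ≤ 17 → Forced (window τ (i + p) ℓ) o → Forced (window τ (i + k) ℓ) o
  move i ℓ o bound = subst (λ w → Forced w o) (sym (window-≡-sub {f = τ} {τ} {k} {p} 17 i ℓ bound eq))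
  moveEnd : EndForced p ⊎ EndForced (2 + p) ⊎ EndForced (9 + p) → EndForced k ⊎ EndForced (2 + k) ⊎ EndForced (9 + k)
  moveEnd (inj₁ end) = inj₁ (move 0 8 7 (m≤m+n 8 9) end)
  moveEnd (inj₂ (inj₁ end)) = inj₂ (inj₁ (move 2 8 7 (m≤m+n 10 7) end))
  moveEnd (inj₂ (inj₂ end)) = inj₂ (inj₂ (move 9 8 7 ≤-refl end))

opaque
  unfolding thueMorse
  factorStarts-locallyForced : All LocallyForced factorStarts
  factorStarts-locallyForced = toWitness {a? = allᴸ? locallyForced? factorStarts} tt

-- Opaque for the same reason as thueMorse.
opaque
  locallyForced : ∀ k → LocallyForced k
  locallyForced k with forced , eq ← lookupAny factorStarts-locallyForced (thueMorse-factor-represented k) =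
    locallyForced-transfer (window-τ-≡ 17 eq) forced

-- Delicate factors of τ

-- How a letter of a factor of length 8 + e is seen to be forced: the first and
-- last through the factors of length 8 at the ends, the others as the second
-- (inner) or third (penultimate) letter of a factor of length 4.
data Position (e : ℕ) : ℕ → Set where
  first       : Position e 0
  inner       : ∀ r rest → r + (4 + rest) ≡ 8 + e → Position e (suc r)
  penultimate : Position e (6 + e)
  last        : Position e (7 + e)

position : ∀ e r → r < 8 + e → Position e r
position e zero _ = first
position e (suc r) (s≤s r<7+e) with m≤n⇒∃[o]m+o≡n r<7+e
... | zero , eq = subst (Position e) (sym (trans (sym (+-identityʳ (suc r))) eq)) last
... | suc zero , eq = subst (Position e) (sym (suc-injective (trans (+-comm 1 (suc r)) eq))) penultimate
... | suc (suc rest) , eq = inner r rest (trans (shuffle r rest) (cong suc eq))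
  where
  shuffle : ∀ r rest → r + (4 + rest) ≡ suc (suc r + suc (suc rest))
  shuffle = solve-∀

delicateWindow : ∀ t e → StartForced t → EndForced (t + e) → DelicateSquarefree (window τ t (8 + e))
delicateWindow t e start end = (λ ()) , window-squarefree τ τ-squarefree t (8 + e) , changeForced
  where
  interior : ∀ j → InteriorForced j
  interior j = proj₁ (locallyForced j)

  forcedAt : ∀ {r a} → Position e r → a ≢ τ (r + t) → ContainsSquare (window (update τ (r + t) a) t (8 + e))
  forcedAt first a≢ = forcedFactor⇒square {c = 0} {ℓ = 8} {r = e} {o = 0} (s≤s z≤n) start a≢ refl refl refl
  forcedAt (inner r rest eq) a≢ =
    forcedFactor⇒square {ℓ = 4} {r = rest} (s≤s (s≤s z≤n)) (proj₁ (interior (r + t))) a≢ refl refl (sym eq)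
  forcedAt penultimate a≢ =
    forcedFactor⇒square {ℓ = 4} {r = 0} (s≤s (s≤s (s≤s z≤n))) (proj₂ (interior (4 + e + t))) a≢
      refl refl (cong (4 +_) (+-comm 4 e))
  forcedAt last a≢ =
    forcedFactor⇒square {ℓ = 8} {r = 0} ≤-refl end a≢ (cong (7 +_) (+-comm e t)) (+-comm t e) (+-comm 8 e)

  changeForced : ∀ k a → a ≢ lookup (window τ t (8 + e)) k → ContainsSquare (window τ t (8 + e) [ k ]∷= a)
  changeForced k a a≢ = subst ContainsSquare (sym changed)
    (forcedAt (position e (toℕ k) k<) λ eq → a≢ (trans eq (sym (lookup-window τ t (8 + e) k))))
    where
    k< : toℕ k < 8 + e
    k< = subst (toℕ k <_) (length-window τ t (8 + e)) (toℕ<n k)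
    changed : window τ t (8 + e) [ k ]∷= a ≡ window (update τ (toℕ k + t) a) t (8 + e)
    changed = trans (∷=-setAt (window τ t (8 + e)) k a) (sym (window-update τ t (8 + e) (toℕ k) a k<))

opaque
  unfolding thueMorse
  startForced : StartForced 1 × StartForced 3 × StartForced 10
  startForced =
    toWitness {a? = forced? (window τ 1 8) 0 ×-dec forced? (window τ 3 8) 0 ×-dec forced? (window τ 10 8) 0} tt

delicateFrom : ∀ t {e} → StartForced t → EndForced (t + e) → ∃ λ w → DelicateSquarefree w × length w ≡ 8 + e
delicateFrom t {e} start end = window τ t (8 + e) , delicateWindow t e start end , length-window τ t (8 + e)

-- Applied at e + 1, the local checks give a forced end to the factor of
-- length 8 + e starting at 1, 3 or 10; all three have a forced start.
delicateOfLength≥8 : ∀ e → ∃ λ w → DelicateSquarefree w × length w ≡ 8 + e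
delicateOfLength≥8 e with proj₂ (locallyForced (suc e))
... | inj₁ end = delicateFrom 1 (proj₁ startForced) end
... | inj₂ (inj₁ end) = delicateFrom 3 (proj₁ (proj₂ startForced)) end
... | inj₂ (inj₂ end) = delicateFrom 10 (proj₂ (proj₂ startForced)) end

noDelicate : ∀ n {absent : True (noDelicateOfLength? n)} → ¬ (∃ λ w → DelicateSquarefree w × length w ≡ n)
noDelicate n {absent} (w , delicate , length≡n) = toWitness absent w length≡n delicate

w₅ w₇ : Word
w₅ = # 0 ∷ # 1 ∷ # 2 ∷ # 1 ∷ # 0 ∷ []
w₇ = # 0 ∷ # 1 ∷ # 0 ∷ # 2 ∷ # 1 ∷ # 0 ∷ # 1 ∷ []

delicate-w₅ : DelicateSquarefree w₅
delicate-w₅ = toWitness {a? = delicateSquarefree? w₅} tt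

delicate-w₇ : DelicateSquarefree w₇
delicate-w₇ = toWitness {a? = delicateSquarefree? w₇} tt

lengthOfDelicate : ∀ n → (∃ λ w → DelicateSquarefree w × length w ≡ n) → n ≡ 5 ⊎ n ≥ 7
lengthOfDelicate 0 = ⊥-elim ∘ noDelicate 0
lengthOfDelicate 1 = ⊥-elim ∘ noDelicate 1
lengthOfDelicate 2 = ⊥-elim ∘ noDelicate 2
lengthOfDelicate 3 = ⊥-elim ∘ noDelicate 3
lengthOfDelicate 4 = ⊥-elim ∘ noDelicate 4
lengthOfDelicate 5 _ = inj₁ refl
lengthOfDelicate 6 = ⊥-elim ∘ noDelicate 6
lengthOfDelicate (suc (suc (suc (suc (suc (suc (suc m))))))) _ = inj₂ (m≤m+n 7 m)

delicateOfLength : ∀ n → n ≡ 5 ⊎ n ≥ 7 → ∃ λ w → DelicateSquarefree w × length w ≡ n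
delicateOfLength _ (inj₁ refl) = w₅ , delicate-w₅ , refl
delicateOfLength n (inj₂ n≥7) with m≤n⇒∃[o]m+o≡n n≥7
... | zero , refl = w₇ , delicate-w₇ , refl
... | suc e , refl = delicateOfLength≥8 e

theorem3 : (n : ℕ) →
    (∃ λ (w : Word) → DelicateSquarefree w × length w ≡ n) ⇔ (n ≡ 5 ⊎ n ≥ 7)
theorem3 n = mk⇔ (lengthOfDelicate n) (delicateOfLength n)
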